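{- Let $\sigma, \tau \in S_n$, and let $i = \sigma^{ -1}(n-1)$, $j = \tau^{ -1}(n-1)$, $a = \tau(i)$, $b = \sigma(j)$, $c = \sigma(n-1)$, and $d = \tau(n-1)$. Write $\Delta{\rm hd}(\sigma,\tau) = {\rm hd}(\sigma,\tau) - {\rm hd}(\sigma^{\mathsf{CT}},\tau^{\mathsf{CT}})$. Then: $\Delta{\rm hd}(\sigma,\tau) = 0$ if and only if one of the following holds: (1) $i$, $j$, $n-1$ pairwise distinct, $a \neq b$ and $c = d$; (2) $i$, $j$, $n-1$ pairwise distinct, $a = b$ and $c = d$; (3) $i = j \neq n-1$, $a = b = n-1$, $c \neq d$; (4) $i = j \neq n-1$, $a = b = n-1$, $c = d$; (5) $i = j = n-1$, $a = b = c = d = n-1$. $\Delta{\rm hd}(\sigma,\tau) = 1$ if and only if one of the following holds: (6) $i$, $j$, $n-1$ pairwise distinct, and $a$, $b$, $c$, $d$ pairwise distinct; (7) $i$, $j$, $n-1$ pairwise distinct, $a = b$, $c \neq d$; (8) $i = n-1 \neq j$, and $a = d$, $b$, $c = n-1$ pairwise distinct; (9) $j = n-1 \neq i$, and $a$, $b = c$, $d = n-1$ pairwise distinct. $\Delta{\rm hd}(\sigma,\tau) = 2$ if and only if one of the following holds: (10) $i$, $j$, $n-1$ pairwise distinct, $a = c$, $b \neq d$; (11) $i$, $j$, $n-1$ pairwise distinct, $a \neq c$, $b = d$; (12) $i = n-1 \neq j$, $a = b = d \neq c = n-1$; (13) $j = n-1 \neq i$, $a = b = c \neq d = n-1$. $\Delta{\rm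 hd}(\sigma,\tau) = 3$ if and only if: (14) $i$, $j$, $n-1$ pairwise distinct, $a = c$, $b = d$.
   Context: $S_n$ is the symmetric group on the symbols $\{0,1,\ldots,n-1\}$. The Hamming distance ${\rm hd}(\sigma,\tau)$ of $\sigma,\tau\in S_n$ is the number of symbols $x$ with $\sigma(x)\neq\tau(x)$. The contraction of $\sigma \in S_n$ is the permutation $\sigma^{\mathsf{CT}} \in S_{n-1}$ defined by $\sigma^{\mathsf{CT}}(x) = \sigma(n-1)$ if $x = \sigma^{ -1}(n-1)$ and $\sigma^{\mathsf{CT}}(x) = \sigma(x)$ otherwise (equivalently, delete the symbol $n-1$ from the disjoint cycle decomposition of $\sigma$). -}

module Defs where

open import Data.Nat using (ℕ; zero; suc)
open import Data.Fin using (Fin; toℕ; fromℕ; inject₁; lower₁; _≟_)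
open import Data.Fin.Properties using (toℕ-fromℕ; toℕ-injective; fromℕ≢inject₁)
open import Data.Fin.Permutation using (Permutation′; _⟨$⟩ʳ_; _⟨$⟩ˡ_; inverseˡ)
open import Data.List using (List; length; filter)
open import Data.List.Base using ()
open import Data.Fin.Base using ()
open import Data.Integer using (ℤ; +_; _-_)
open import Relation.Nullary using (¬_; ¬?; yes; no)
open import Relation.Binary.PropositionalEquality using (_≡_; _≢_; refl; sym; trans; cong)
open import Data.List using (allFin)

top : (m : ℕ) → Fin (suc m)
top m = fromℕ m

private
  ≢top⇒ : ∀ {m} (v : Fin (suc m)) → v ≢ top m → m ≢ toℕ v
  ≢top⇒ {m} v ne eq = ne (toℕ-injective (trans (sym eq) (sym (toℕ-fromℕ m))))

  σtop≢top : ∀ {m} (σ : Permutation′ (suc m)) (x : Fin m) →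
             σ ⟨$⟩ʳ inject₁ x ≡ top m → σ ⟨$⟩ʳ top m ≢ top m
  σtop≢top {m} σ x e e′ =
    fromℕ≢inject₁ (trans (sym (inverseˡ σ)) (trans (cong (σ ⟨$⟩ˡ_) (trans e′ (sym e))) (inverseˡ σ)))

contraction : ∀ {m} → Permutation′ (suc m) → Fin m → Fin m
contraction {m} σ x with σ ⟨$⟩ʳ inject₁ x ≟ top m
... | yes e = lower₁ (σ ⟨$⟩ʳ top m) (≢top⇒ (σ ⟨$⟩ʳ top m) (σtop≢top σ x e))
... | no ne = lower₁ (σ ⟨$⟩ʳ inject₁ x) (≢top⇒ (σ ⟨$⟩ʳ inject₁ x) ne)

hdFun : ∀ {n} → (Fin n → Fin n) → (Fin n → Fin n) → ℕ
hdFun {n} f g = length (filter (λ x → ¬? (f x ≟ g x)) (allFin n))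

hd : ∀ {n} → Permutation′ n → Permutation′ n → ℕ
hd σ τ = hdFun (σ ⟨$⟩ʳ_) (τ ⟨$⟩ʳ_)

Δhd : ∀ {m} → Permutation′ (suc m) → Permutation′ (suc m) → ℤ
Δhd σ τ = + hd σ τ - + hdFun (contraction σ) (contraction τ)

-- hd (σᶜᵗ, τᶜᵗ) = hd (σ ∘ (i N), τ ∘ (j N)), because σ ∘ (i N) agrees with σᶜᵗ below N = n-1 and
-- fixes N.  Reindexing along (i N) turns this into hd (σ, τ′) with τ′ = τ ∘ (j N) ∘ (N i), and τ′
-- differs from τ at most at i, j and N.  Adding up the local changes at these points gives
--   Δhd = 0                                  if i = j,
--   Δhd = 2 - [b ≠ d]                        if i = N ≠ j,
--   Δhd = 2 - [c ≠ a]                        if j = N ≠ i,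
--   Δhd = 2 + [c ≠ d] - [b ≠ d] - [c ≠ a]    if i, j, N are distinct,
-- and the fourteen cases are the ways these indicators can combine.

module Submission where

open import Defs
open import Data.Nat using (ℕ; zero; suc; _+_)
open import Data.Nat.Properties using (+-0-commutativeMonoid; +-commutativeSemigroup; +-assoc; +-comm; +-identityʳ)
open import Data.Nat.ListAction using () renaming (sum to sumˡ)
open import Data.Integer using (ℤ; +_; -[1+_]; _⊖_)
open import Data.Integer.Properties using (m-n≡m⊖n; +-cancelˡ-⊖)
open import Data.Fin using (Fin; zero; suc; inject₁; _≟_)
open import Data.Fin.Properties using (inject₁-lower₁; inject₁-injective; fromℕ≢inject₁; punchInᵢ≢i)
open import Data.Fin.Permutation using (Permutation′; _⟨$⟩ʳ_; _⟨$⟩ˡ_; inverseˡ; inverseʳ)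
import Data.Fin.Permutation as Perm
open import Data.Fin.Permutation.Components using (transpose; transpose-inverse)
open import Data.List using (List; []; _∷_; map; filter; length; tabulate)
open import Data.List.Properties using (map-cong-local)
import Data.List.Relation.Unary.All as All
open All using ([]; _∷_)
open import Data.List.Relation.Unary.Unique.Propositional using (Unique; []; _∷_)
open import Data.List.Membership.Propositional using (_∉_)
open import Data.List.Relation.Unary.Any using (here; there)
open import Data.Vec.Functional using (updateAt; removeAt)
open import Data.Vec.Functional.Properties using (updateAt-updates; updateAt-minimal)
open import Data.Product using (Σ; _×_; _,_)
open import Data.Sum using (_⊎_; inj₁; inj₂)
open import Data.Empty using (⊥; ⊥-elim)
open import Function using (_∘_; Injective)
open import Function.Bundles using (_⇔_; mk⇔; Injection)
open import Function.Properties.Inverse using (↔⇒↣)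
open import Relation.Nullary using (Dec; ¬?; yes; no)
open import Relation.Nullary.Decidable using (dec-true; dec-false)
open import Relation.Binary.PropositionalEquality

open import Algebra.Properties.CommutativeMonoid.Sum +-0-commutativeMonoid
  using (sum; sum-syntax; sum-cong-≗; sum-init-last; sum-remove; sum-permute)
open import Algebra.Properties.CommutativeSemigroup +-commutativeSemigroup
  using (xy∙z≈xz∙y; xy∙z≈zy∙x)

private
  variable
    n : ℕ

mismatch : Fin n → Fin n → ℕ
mismatch x y with x ≟ y
... | yes _ = 0
... | no _ = 1

mismatch-≡ : ∀ {x y : Fin n} → x ≡ y → mismatch x y ≡ 0
mismatch-≡ {x = x} {y} x≡y with x ≟ y
... | yes _ = refl
... | no x≢y = ⊥-elim (x≢y x≡y)

mismatch-≢ : ∀ {x y : Fin n} → x ≢ y → mismatch x y ≡ 1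
mismatch-≢ {x = x} {y} x≢y with x ≟ y
... | yes x≡y = ⊥-elim (x≢y x≡y)
... | no _ = refl

mismatch-injective : ∀ {m} {f : Fin m → Fin n} → Injective _≡_ _≡_ f →
                     ∀ x y → mismatch (f x) (f y) ≡ mismatch x y
mismatch-injective f-inj x y with x ≟ y
... | yes x≡y = mismatch-≡ (cong _ x≡y)
... | no x≢y = mismatch-≢ (x≢y ∘ f-inj)

length-filter-mismatch : ∀ {k} (f g : Fin n → Fin n) (h : Fin k → Fin n) →
  length (filter (λ x → ¬? (f x ≟ g x)) (tabulate h)) ≡ ∑[ x < k ] mismatch (f (h x)) (g (h x))
length-filter-mismatch {k = zero} f g h = refl
length-filter-mismatch {k = suc k} f g h with f (h zero) ≟ g (h zero)
... | yes _ = length-filter-mismatch f g (h ∘ suc)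
... | no _ = cong suc (length-filter-mismatch f g (h ∘ suc))

hdFun≡∑mismatch : (f g : Fin n → Fin n) → hdFun f g ≡ ∑[ x < n ] mismatch (f x) (g x)
hdFun≡∑mismatch f g = length-filter-mismatch f g (λ x → x)

sum-updateAt : (u : Fin n → ℕ) (p : Fin n) (f : ℕ → ℕ) →
               sum (updateAt u p f) + u p ≡ sum u + f (u p)
sum-updateAt {suc n} u p f = begin
  sum w + u p                           ≡⟨ cong (_+ u p) (sum-remove {i = p} w) ⟩
  w p + sum (removeAt w p) + u p        ≡⟨ cong₂ (λ s t → s + t + u p) (updateAt-updates p u) (sum-cong-≗ w≗u) ⟩
  f (u p) + sum (removeAt u p) + u p    ≡⟨ xy∙z≈zy∙x (f (u p)) _ (u p) ⟩
  u p + sum (removeAt u p) + f (u p)    ≡⟨ cong (_+ f (u p)) (sum-remove {i = p} u) ⟨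
  sum u + f (u p)                       ∎
  where
  open ≡-Reasoning
  w : Fin (suc n) → ℕ
  w = updateAt u p f
  w≗u : ∀ x → removeAt w p x ≡ removeAt u p x
  w≗u x = updateAt-minimal _ p u (punchInᵢ≢i p x)

sum-agree-off : (u v : Fin n → ℕ) {ps : List (Fin n)} → Unique ps → (∀ x → x ∉ ps → u x ≡ v x) →
                sum u + sumˡ (map v ps) ≡ sum v + sumˡ (map u ps)
sum-agree-off u v [] agree = cong (_+ 0) (sum-cong-≗ (λ x → agree x λ ()))
sum-agree-off {n} u v {p ∷ ps} (p≢ps ∷ unique) agree = begin
  sum u + (v p + Sv)       ≡⟨ +-assoc (sum u) (v p) Sv ⟨
  sum u + v p + Sv         ≡⟨ cong (_+ Sv) (sum-updateAt u p (λ _ → v p)) ⟨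
  sum w + u p + Sv         ≡⟨ xy∙z≈xz∙y (sum w) (u p) Sv ⟩
  sum w + Sv + u p         ≡⟨ cong (_+ u p) (sum-agree-off w v unique w-agree) ⟩
  sum v + sumˡ (map w ps) + u p
    ≡⟨ cong (λ s → sum v + sumˡ s + u p) (map-cong-local (All.map w≡u p≢ps)) ⟩
  sum v + Su + u p         ≡⟨ xy∙z≈xz∙y (sum v) Su (u p) ⟩
  sum v + u p + Su         ≡⟨ +-assoc (sum v) (u p) Su ⟩
  sum v + (u p + Su)       ∎
  where
  open ≡-Reasoning
  Sv Su : ℕ
  Sv = sumˡ (map v ps)
  Su = sumˡ (map u ps)
  w : Fin n → ℕ
  w = updateAt u p (λ _ → v p)
  w≡u : ∀ {q} → p ≢ q → w q ≡ u q
  w≡u p≢q = updateAt-minimal _ p u (p≢q ∘ sym)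
  w-agree : ∀ x → x ∉ ps → w x ≡ v x
  w-agree x x∉ps with x ≟ p
  ... | yes refl = updateAt-updates p u
  ... | no x≢p = trans (updateAt-minimal x p u x≢p)
                       (agree x λ { (here x≡p) → x≢p x≡p ; (there x∈ps) → x∉ps x∈ps })

⊖-balance : ∀ {m n p q} → m + p ≡ n + q → m ⊖ n ≡ q ⊖ p
⊖-balance {m} {n} {p} {q} eq = begin
  m ⊖ n              ≡⟨ +-cancelˡ-⊖ p m n ⟨
  (p + m) ⊖ (p + n)  ≡⟨ cong₂ _⊖_ (trans (+-comm p m) eq) (+-comm p n) ⟩
  (n + q) ⊖ (n + p)  ≡⟨ +-cancelˡ-⊖ n q p ⟩
  q ⊖ p              ∎
  where open ≡-Reasoning

transpose-matchˡ : (i j : Fin n) → transpose i j i ≡ j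
transpose-matchˡ i j rewrite dec-true (i ≟ i) refl = refl

transpose-matchʳ : (i j : Fin n) → transpose i j j ≡ i
transpose-matchʳ i j with j ≟ i
... | yes j≡i = j≡i
... | no _ rewrite dec-true (j ≟ j) refl = refl

transpose-other : ∀ {i j k : Fin n} → k ≢ i → k ≢ j → transpose i j k ≡ k
transpose-other {i = i} {j} {k} k≢i k≢j rewrite dec-false (k ≟ i) k≢i | dec-false (k ≟ j) k≢j = refl

⟨$⟩ʳ-injective : (π : Permutation′ n) → Injective _≡_ _≡_ (π ⟨$⟩ʳ_)
⟨$⟩ʳ-injective π = Injection.injective (↔⇒↣ π)

inject₁-contraction : ∀ {m} (σ : Permutation′ (suc m)) (x : Fin m) →
  inject₁ (contraction σ x) ≡ σ ⟨$⟩ʳ transpose (σ ⟨$⟩ˡ top m) (top m) (inject₁ x)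
inject₁-contraction {m} σ x with σ ⟨$⟩ʳ inject₁ x ≟ top m
... | yes σx≡N = trans (inject₁-lower₁ _ _) (cong (σ ⟨$⟩ʳ_) (sym x↦N))
  where
  i≡x : σ ⟨$⟩ˡ top m ≡ inject₁ x
  i≡x = trans (cong (σ ⟨$⟩ˡ_) (sym σx≡N)) (inverseˡ σ)
  x↦N : transpose (σ ⟨$⟩ˡ top m) (top m) (inject₁ x) ≡ top m
  x↦N = trans (cong (λ y → transpose y (top m) (inject₁ x)) i≡x) (transpose-matchˡ (inject₁ x) (top m))
... | no σx≢N =
  trans (inject₁-lower₁ _ _) (cong (σ ⟨$⟩ʳ_) (sym (transpose-other x≢i (fromℕ≢inject₁ ∘ sym))))
  where
  x≢i : inject₁ x ≢ σ ⟨$⟩ˡ top m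
  x≢i x≡i = σx≢N (trans (cong (σ ⟨$⟩ʳ_) x≡i) (inverseʳ σ))

cases⇒≡⇔ : ∀ {A : Set} {x : A} (C : A → Set) → (∀ {k} → C k → x ≡ k) → Σ A C →
           ∀ k → (x ≡ k) ⇔ C k
cases⇒≡⇔ C sound (k′ , c′) k = mk⇔ (λ x≡k → subst C (trans (sym (sound c′)) x≡k) c′) sound

module Configuration {m : ℕ} (σ τ : Permutation′ (suc m)) where

  N i j a b c d : Fin (suc m)
  N = top m
  i = σ ⟨$⟩ˡ N
  j = τ ⟨$⟩ˡ N
  a = τ ⟨$⟩ʳ i
  b = σ ⟨$⟩ʳ j
  c = σ ⟨$⟩ʳ N
  d = τ ⟨$⟩ʳ N

  σi≡N : σ ⟨$⟩ʳ i ≡ N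
  σi≡N = inverseʳ σ

  τj≡N : τ ⟨$⟩ʳ j ≡ N
  τj≡N = inverseʳ τ

  i≡j⇒a≡N : i ≡ j → a ≡ N
  i≡j⇒a≡N i≡j = trans (cong (τ ⟨$⟩ʳ_) i≡j) τj≡N

  i≡j⇒b≡N : i ≡ j → b ≡ N
  i≡j⇒b≡N i≡j = trans (cong (σ ⟨$⟩ʳ_) (sym i≡j)) σi≡N

  a≡N⇒i≡j : a ≡ N → i ≡ j
  a≡N⇒i≡j a≡N = ⟨$⟩ʳ-injective τ (trans a≡N (sym τj≡N))

  b≡N⇒i≡j : b ≡ N → i ≡ j
  b≡N⇒i≡j b≡N = ⟨$⟩ʳ-injective σ (trans σi≡N (sym b≡N))

  i≡N⇒c≡N : i ≡ N → c ≡ N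
  i≡N⇒c≡N i≡N = trans (cong (σ ⟨$⟩ʳ_) (sym i≡N)) σi≡N

  c≡N⇒i≡N : c ≡ N → i ≡ N
  c≡N⇒i≡N c≡N = ⟨$⟩ʳ-injective σ (trans σi≡N (sym c≡N))

  j≡N⇒d≡N : j ≡ N → d ≡ N
  j≡N⇒d≡N j≡N = trans (cong (τ ⟨$⟩ʳ_) (sym j≡N)) τj≡N

  d≡N⇒j≡N : d ≡ N → j ≡ N
  d≡N⇒j≡N d≡N = ⟨$⟩ʳ-injective τ (trans τj≡N (sym d≡N))

  i≡N⇒a≡d : i ≡ N → a ≡ d
  i≡N⇒a≡d = cong (τ ⟨$⟩ʳ_)

  a≡d⇒i≡N : a ≡ d → i ≡ N
  a≡d⇒i≡N = ⟨$⟩ʳ-injective τ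

  j≡N⇒b≡c : j ≡ N → b ≡ c
  j≡N⇒b≡c = cong (σ ⟨$⟩ʳ_)

  b≡c⇒j≡N : b ≡ c → j ≡ N
  b≡c⇒j≡N = ⟨$⟩ʳ-injective σ

  τ′ : Fin (suc m) → Fin (suc m)
  τ′ y = τ ⟨$⟩ʳ transpose j N (transpose N i y)

  τ′-diagonal : i ≡ j → ∀ y → τ′ y ≡ τ ⟨$⟩ʳ y
  τ′-diagonal i≡j y =
    cong (τ ⟨$⟩ʳ_) (trans (cong (λ z → transpose j N (transpose N z y)) i≡j) (transpose-inverse j N))

  τ′-other : ∀ {y} → y ≢ i → y ≢ j → y ≢ N → τ′ y ≡ τ ⟨$⟩ʳ y
  τ′-other y≢i y≢j y≢N =
    cong (τ ⟨$⟩ʳ_) (trans (cong (transpose j N) (transpose-other y≢N y≢i)) (transpose-other y≢j y≢N))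

  τ′-i : τ′ i ≡ N
  τ′-i = trans (cong (τ ⟨$⟩ʳ_) (trans (cong (transpose j N) (transpose-matchʳ N i)) (transpose-matchʳ j N)))
               τj≡N

  τ′-j : i ≢ j → j ≢ N → τ′ j ≡ d
  τ′-j i≢j j≢N =
    cong (τ ⟨$⟩ʳ_) (trans (cong (transpose j N) (transpose-other j≢N (i≢j ∘ sym))) (transpose-matchˡ j N))

  τ′-N : i ≢ j → i ≢ N → τ′ N ≡ a
  τ′-N i≢j i≢N =
    cong (τ ⟨$⟩ʳ_) (trans (cong (transpose j N) (transpose-matchˡ N i)) (transpose-other i≢j i≢N))

  hd-contraction : hdFun (contraction σ) (contraction τ) ≡ ∑[ y < suc m ] mismatch (σ ⟨$⟩ʳ y) (τ′ y)
  hd-contraction = begin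
    hdFun (contraction σ) (contraction τ)
      ≡⟨ hdFun≡∑mismatch (contraction σ) (contraction τ) ⟩
    ∑[ x < m ] mismatch (contraction σ x) (contraction τ x)
      ≡⟨ sum-cong-≗ (λ x → trans (sym (mismatch-injective inject₁-injective _ _))
                                 (cong₂ mismatch (inject₁-contraction σ x) (inject₁-contraction τ x))) ⟩
    ∑[ x < m ] F (inject₁ x)
      ≡⟨ +-identityʳ _ ⟨
    ∑[ x < m ] F (inject₁ x) + 0
      ≡⟨ cong (λ s → sum (F ∘ inject₁) + s) F-N≡0 ⟨
    ∑[ x < m ] F (inject₁ x) + F N
      ≡⟨ sum-init-last F ⟨
    sum F
      ≡⟨ sum-cong-≗ (λ y → cong (λ z → mismatch (σ ⟨$⟩ʳ transpose i N y) (τ ⟨$⟩ʳ transpose j N z))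
                                (transpose-inverse N i {y})) ⟨
    ∑[ y < suc m ] G (transpose i N y)
      ≡⟨ sum-permute G (Perm.transpose i N) ⟨
    sum G ∎
    where
    open ≡-Reasoning
    G : Fin (suc m) → ℕ
    G y = mismatch (σ ⟨$⟩ʳ y) (τ′ y)
    F : Fin (suc m) → ℕ
    F y = mismatch (σ ⟨$⟩ʳ transpose i N y) (τ ⟨$⟩ʳ transpose j N y)
    F-N≡0 : F N ≡ 0
    F-N≡0 = mismatch-≡ (trans (cong (σ ⟨$⟩ʳ_) (transpose-matchʳ i N))
                       (trans σi≡N (sym (trans (cong (τ ⟨$⟩ʳ_) (transpose-matchʳ j N)) τj≡N))))

  Δhd-local : ∀ {ps} → Unique ps → (∀ y → y ∉ ps → τ′ y ≡ τ ⟨$⟩ʳ y) →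
              Δhd σ τ ≡ sumˡ (map (λ y → mismatch (σ ⟨$⟩ʳ y) (τ ⟨$⟩ʳ y)) ps)
                        ⊖ sumˡ (map (λ y → mismatch (σ ⟨$⟩ʳ y) (τ′ y)) ps)
  Δhd-local {ps} unique agree = begin
    Δhd σ τ
      ≡⟨ m-n≡m⊖n (hd σ τ) (hdFun (contraction σ) (contraction τ)) ⟩
    hd σ τ ⊖ hdFun (contraction σ) (contraction τ)
      ≡⟨ cong₂ _⊖_ (hdFun≡∑mismatch (σ ⟨$⟩ʳ_) (τ ⟨$⟩ʳ_)) hd-contraction ⟩
    sum u ⊖ sum v
      ≡⟨ ⊖-balance {sum u} {sum v} (sum-agree-off u v unique u≡v) ⟩
    sumˡ (map u ps) ⊖ sumˡ (map v ps) ∎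
    where
    open ≡-Reasoning
    u v : Fin (suc m) → ℕ
    u y = mismatch (σ ⟨$⟩ʳ y) (τ ⟨$⟩ʳ y)
    v y = mismatch (σ ⟨$⟩ʳ y) (τ′ y)
    u≡v : ∀ y → y ∉ ps → u y ≡ v y
    u≡v y y∉ps = cong (mismatch (σ ⟨$⟩ʳ y)) (sym (agree y y∉ps))

  mismatch-i : i ≢ j → mismatch (σ ⟨$⟩ʳ i) (τ ⟨$⟩ʳ i) ≡ 1
  mismatch-i i≢j = mismatch-≢ (λ N≡a → i≢j (a≡N⇒i≡j (sym (trans (sym σi≡N) N≡a))))

  mismatch-j : i ≢ j → mismatch (σ ⟨$⟩ʳ j) (τ ⟨$⟩ʳ j) ≡ 1
  mismatch-j i≢j = mismatch-≢ (λ b≡N → i≢j (b≡N⇒i≡j (trans b≡N τj≡N)))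

  mismatch′-i : mismatch (σ ⟨$⟩ʳ i) (τ′ i) ≡ 0
  mismatch′-i = mismatch-≡ (trans σi≡N (sym τ′-i))

  Δhd-diagonal : i ≡ j → Δhd σ τ ≡ + 0
  Δhd-diagonal i≡j = Δhd-local [] (λ y _ → τ′-diagonal i≡j y)

  -- Below, the indicator values are parameters, so that in each concrete case the right-hand side
  -- is a literal.
  Δhd-top-i : ∀ {q} → i ≡ N → j ≢ N → mismatch b d ≡ q → Δhd σ τ ≡ 2 ⊖ q
  Δhd-top-i {q} i≡N j≢N bd≡q =
    trans (Δhd-local ((j≢N ∷ []) ∷ [] ∷ []) agree)
          (cong₂ _⊖_ (cong₂ _+_ (mismatch-j i≢j) (cong (_+ 0) mismatch-cd)) v≡q)
    where
    i≢j : i ≢ j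
    i≢j i≡j = j≢N (trans (sym i≡j) i≡N)
    mismatch-cd : mismatch c d ≡ 1
    mismatch-cd = mismatch-≢ (λ c≡d → j≢N (d≡N⇒j≡N (trans (sym c≡d) (i≡N⇒c≡N i≡N))))
    agree : ∀ y → y ∉ j ∷ N ∷ [] → τ′ y ≡ τ ⟨$⟩ʳ y
    agree y y∉ps =
      τ′-other (λ y≡i → y∉ps (there (here (trans y≡i i≡N)))) (y∉ps ∘ here) (y∉ps ∘ there ∘ here)
    τ′N≡N : τ′ N ≡ N
    τ′N≡N = trans (cong τ′ (sym i≡N)) τ′-i
    v≡q : mismatch b (τ′ j) + (mismatch c (τ′ N) + 0) ≡ q
    v≡q = trans (cong₂ _+_ (trans (cong (mismatch b) (τ′-j i≢j j≢N)) bd≡q)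
                           (cong (_+ 0) (mismatch-≡ (trans (i≡N⇒c≡N i≡N) (sym τ′N≡N)))))
                (+-identityʳ q)

  Δhd-top-j : ∀ {r} → j ≡ N → i ≢ N → mismatch c a ≡ r → Δhd σ τ ≡ 2 ⊖ r
  Δhd-top-j {r} j≡N i≢N ca≡r =
    trans (Δhd-local ((i≢N ∷ []) ∷ [] ∷ []) agree)
          (cong₂ _⊖_ (cong₂ _+_ (mismatch-i i≢j) (cong (_+ 0) mismatch-cd)) v≡r)
    where
    i≢j : i ≢ j
    i≢j i≡j = i≢N (trans i≡j j≡N)
    mismatch-cd : mismatch c d ≡ 1
    mismatch-cd = mismatch-≢ (λ c≡d → i≢N (c≡N⇒i≡N (trans c≡d (j≡N⇒d≡N j≡N))))
    agree : ∀ y → y ∉ i ∷ N ∷ [] → τ′ y ≡ τ ⟨$⟩ʳ y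
    agree y y∉ps =
      τ′-other (y∉ps ∘ here) (λ y≡j → y∉ps (there (here (trans y≡j j≡N)))) (y∉ps ∘ there ∘ here)
    v≡r : mismatch (σ ⟨$⟩ʳ i) (τ′ i) + (mismatch c (τ′ N) + 0) ≡ r
    v≡r = trans (cong₂ _+_ mismatch′-i (cong (_+ 0) (trans (cong (mismatch c) (τ′-N i≢j i≢N)) ca≡r)))
                (+-identityʳ r)

  Δhd-distinct : ∀ {p q r} → i ≢ j → i ≢ N → j ≢ N →
                 mismatch c d ≡ p → mismatch b d ≡ q → mismatch c a ≡ r → Δhd σ τ ≡ (2 + p) ⊖ (q + r)
  Δhd-distinct i≢j i≢N j≢N cd≡p bd≡q ca≡r =
    trans (Δhd-local ((i≢j ∷ i≢N ∷ []) ∷ (j≢N ∷ []) ∷ [] ∷ []) agree)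
          (cong₂ _⊖_ (cong₂ _+_ (mismatch-i i≢j) (cong₂ _+_ (mismatch-j i≢j) (trans (+-identityʳ _) cd≡p)))
                     (cong₂ _+_ mismatch′-i
                       (cong₂ _+_ (trans (cong (mismatch b) (τ′-j i≢j j≢N)) bd≡q)
                                  (trans (+-identityʳ _) (trans (cong (mismatch c) (τ′-N i≢j i≢N)) ca≡r)))))
    where
    agree : ∀ y → y ∉ i ∷ j ∷ N ∷ [] → τ′ y ≡ τ ⟨$⟩ʳ y
    agree y y∉ps = τ′-other (y∉ps ∘ here) (y∉ps ∘ there ∘ here) (y∉ps ∘ there ∘ there ∘ here)

  Distinct : Set
  Distinct = (i ≢ j) × (i ≢ N) × (j ≢ N)

  Cases : ℤ → Set
  Cases (+ 0) = (Distinct × a ≢ b × c ≡ d)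
              ⊎ (Distinct × a ≡ b × c ≡ d)
              ⊎ (i ≡ j × i ≢ N × a ≡ N × b ≡ N × c ≢ d)
              ⊎ (i ≡ j × i ≢ N × a ≡ N × b ≡ N × c ≡ d)
              ⊎ (i ≡ N × j ≡ N × a ≡ N × b ≡ N × c ≡ N × d ≡ N)
  Cases (+ 1) = (Distinct × a ≢ b × a ≢ c × a ≢ d × b ≢ c × b ≢ d × c ≢ d)
              ⊎ (Distinct × a ≡ b × c ≢ d)
              ⊎ (i ≡ N × N ≢ j × a ≡ d × c ≡ N × a ≢ b × b ≢ c × a ≢ c)
              ⊎ (j ≡ N × N ≢ i × b ≡ c × d ≡ N × a ≢ b × b ≢ d × a ≢ d)
  Cases (+ 2) = (Distinct × a ≡ c × b ≢ d)
              ⊎ (Distinct × a ≢ c × b ≡ d)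
              ⊎ (i ≡ N × N ≢ j × a ≡ b × b ≡ d × d ≢ c × c ≡ N)
              ⊎ (j ≡ N × N ≢ i × a ≡ b × b ≡ c × c ≢ d × d ≡ N)
  Cases (+ 3) = Distinct × a ≡ c × b ≡ d
  Cases _     = ⊥

  c≡d⇒Δhd≡0 : Distinct → c ≡ d → Δhd σ τ ≡ + 0
  c≡d⇒Δhd≡0 (i≢j , i≢N , j≢N) c≡d =
    Δhd-distinct i≢j i≢N j≢N (mismatch-≡ c≡d)
      (mismatch-≢ λ b≡d → j≢N (b≡c⇒j≡N (trans b≡d (sym c≡d))))
      (mismatch-≢ λ c≡a → i≢N (a≡d⇒i≡N (trans (sym c≡a) c≡d)))

  Δhd-cases : ∀ {k} → Cases k → Δhd σ τ ≡ k
  Δhd-cases {+ 0} (inj₁ (dist , _ , c≡d)) = c≡d⇒Δhd≡0 dist c≡d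
  Δhd-cases {+ 0} (inj₂ (inj₁ (dist , _ , c≡d))) = c≡d⇒Δhd≡0 dist c≡d
  Δhd-cases {+ 0} (inj₂ (inj₂ (inj₁ (i≡j , _)))) = Δhd-diagonal i≡j
  Δhd-cases {+ 0} (inj₂ (inj₂ (inj₂ (inj₁ (i≡j , _))))) = Δhd-diagonal i≡j
  Δhd-cases {+ 0} (inj₂ (inj₂ (inj₂ (inj₂ (i≡N , j≡N , _))))) = Δhd-diagonal (trans i≡N (sym j≡N))
  Δhd-cases {+ 1} (inj₁ ((i≢j , i≢N , j≢N) , _ , a≢c , _ , _ , b≢d , c≢d)) =
    Δhd-distinct i≢j i≢N j≢N (mismatch-≢ c≢d) (mismatch-≢ b≢d) (mismatch-≢ (a≢c ∘ sym))
  Δhd-cases {+ 1} (inj₂ (inj₁ ((i≢j , i≢N , j≢N) , a≡b , c≢d))) =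
    Δhd-distinct i≢j i≢N j≢N (mismatch-≢ c≢d)
      (mismatch-≢ λ b≡d → i≢N (a≡d⇒i≡N (trans a≡b b≡d)))
      (mismatch-≢ λ c≡a → j≢N (b≡c⇒j≡N (trans (sym a≡b) (sym c≡a))))
  Δhd-cases {+ 1} (inj₂ (inj₂ (inj₁ (i≡N , N≢j , a≡d , _ , a≢b , _)))) =
    Δhd-top-i i≡N (N≢j ∘ sym) (mismatch-≢ λ b≡d → a≢b (trans a≡d (sym b≡d)))
  Δhd-cases {+ 1} (inj₂ (inj₂ (inj₂ (j≡N , N≢i , b≡c , _ , a≢b , _)))) =
    Δhd-top-j j≡N (N≢i ∘ sym) (mismatch-≢ λ c≡a → a≢b (trans (sym c≡a) (sym b≡c)))
  Δhd-cases {+ 2} (inj₁ ((i≢j , i≢N , j≢N) , a≡c , b≢d)) =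
    Δhd-distinct i≢j i≢N j≢N (mismatch-≢ λ c≡d → i≢N (a≡d⇒i≡N (trans a≡c c≡d)))
      (mismatch-≢ b≢d) (mismatch-≡ (sym a≡c))
  Δhd-cases {+ 2} (inj₂ (inj₁ ((i≢j , i≢N , j≢N) , a≢c , b≡d))) =
    Δhd-distinct i≢j i≢N j≢N (mismatch-≢ λ c≡d → j≢N (b≡c⇒j≡N (trans b≡d (sym c≡d))))
      (mismatch-≡ b≡d) (mismatch-≢ (a≢c ∘ sym))
  Δhd-cases {+ 2} (inj₂ (inj₂ (inj₁ (i≡N , N≢j , _ , b≡d , _)))) =
    Δhd-top-i i≡N (N≢j ∘ sym) (mismatch-≡ b≡d)
  Δhd-cases {+ 2} (inj₂ (inj₂ (inj₂ (j≡N , N≢i , a≡b , b≡c , _)))) =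
    Δhd-top-j j≡N (N≢i ∘ sym) (mismatch-≡ (sym (trans a≡b b≡c)))
  Δhd-cases {+ 3} ((i≢j , i≢N , j≢N) , a≡c , b≡d) =
    Δhd-distinct i≢j i≢N j≢N (mismatch-≢ λ c≡d → i≢N (a≡d⇒i≡N (trans a≡c c≡d)))
      (mismatch-≡ b≡d) (mismatch-≡ (sym a≡c))
  Δhd-cases {+ suc (suc (suc (suc _)))} ()
  Δhd-cases { -[1+ _ ]} ()

  cases-diagonal : i ≡ j → Σ ℤ Cases
  cases-diagonal i≡j with i ≟ N | c ≟ d
  ... | yes i≡N | _ = + 0 , inj₂ (inj₂ (inj₂ (inj₂
        (i≡N , j≡N , i≡j⇒a≡N i≡j , i≡j⇒b≡N i≡j , i≡N⇒c≡N i≡N , j≡N⇒d≡N j≡N))))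
    where
    j≡N : j ≡ N
    j≡N = trans (sym i≡j) i≡N
  ... | no i≢N | yes c≡d =
    + 0 , inj₂ (inj₂ (inj₂ (inj₁ (i≡j , i≢N , i≡j⇒a≡N i≡j , i≡j⇒b≡N i≡j , c≡d))))
  ... | no i≢N | no c≢d =
    + 0 , inj₂ (inj₂ (inj₁ (i≡j , i≢N , i≡j⇒a≡N i≡j , i≡j⇒b≡N i≡j , c≢d)))

  cases-top-i : i ≢ j → i ≡ N → Σ ℤ Cases
  cases-top-i i≢j i≡N = by-b≟d (b ≟ d)
    where
    N≢j : N ≢ j
    N≢j N≡j = i≢j (trans i≡N N≡j)
    a≡d : a ≡ d
    a≡d = i≡N⇒a≡d i≡N
    c≡N : c ≡ N
    c≡N = i≡N⇒c≡N i≡N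
    by-b≟d : Dec (b ≡ d) → Σ ℤ Cases
    by-b≟d (yes b≡d) = + 2 , inj₂ (inj₂ (inj₁ (i≡N , N≢j , trans a≡d (sym b≡d) , b≡d ,
                         (λ d≡c → N≢j (sym (d≡N⇒j≡N (trans d≡c c≡N)))) , c≡N)))
    by-b≟d (no b≢d) = + 1 , inj₂ (inj₂ (inj₁ (i≡N , N≢j , a≡d , c≡N ,
                         (λ a≡b → b≢d (trans (sym a≡b) a≡d)) ,
                         (λ b≡c → N≢j (sym (b≡c⇒j≡N b≡c))) ,
                         (λ a≡c → N≢j (sym (d≡N⇒j≡N (trans (sym a≡d) (trans a≡c c≡N))))))))

  cases-top-j : i ≢ j → j ≡ N → Σ ℤ Cases
  cases-top-j i≢j j≡N = by-a≟c (a ≟ c)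
    where
    N≢i : N ≢ i
    N≢i N≡i = i≢j (trans (sym N≡i) (sym j≡N))
    b≡c : b ≡ c
    b≡c = j≡N⇒b≡c j≡N
    d≡N : d ≡ N
    d≡N = j≡N⇒d≡N j≡N
    by-a≟c : Dec (a ≡ c) → Σ ℤ Cases
    by-a≟c (yes a≡c) = + 2 , inj₂ (inj₂ (inj₂ (j≡N , N≢i , trans a≡c (sym b≡c) , b≡c ,
                         (λ c≡d → N≢i (sym (c≡N⇒i≡N (trans c≡d d≡N)))) , d≡N)))
    by-a≟c (no a≢c) = + 1 , inj₂ (inj₂ (inj₂ (j≡N , N≢i , b≡c , d≡N ,
                         (λ a≡b → a≢c (trans a≡b b≡c)) ,
                         (λ b≡d → N≢i (sym (c≡N⇒i≡N (trans (sym b≡c) (trans b≡d d≡N))))) ,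
                         (λ a≡d → N≢i (sym (a≡d⇒i≡N a≡d))))))

  cases-distinct : Distinct → Σ ℤ Cases
  cases-distinct dist@(i≢j , i≢N , j≢N) with c ≟ d | a ≟ b | a ≟ c | b ≟ d
  ... | yes c≡d | yes a≡b | _ | _ = + 0 , inj₂ (inj₁ (dist , a≡b , c≡d))
  ... | yes c≡d | no a≢b | _ | _ = + 0 , inj₁ (dist , a≢b , c≡d)
  ... | no c≢d | _ | yes a≡c | yes b≡d = + 3 , dist , a≡c , b≡d
  ... | no c≢d | _ | yes a≡c | no b≢d = + 2 , inj₁ (dist , a≡c , b≢d)
  ... | no c≢d | _ | no a≢c | yes b≡d = + 2 , inj₂ (inj₁ (dist , a≢c , b≡d))
  ... | no c≢d | yes a≡b | no a≢c | no b≢d = + 1 , inj₂ (inj₁ (dist , a≡b , c≢d))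
  ... | no c≢d | no a≢b | no a≢c | no b≢d =
    + 1 , inj₁ (dist , a≢b , a≢c , i≢N ∘ a≡d⇒i≡N , j≢N ∘ b≡c⇒j≡N , b≢d , c≢d)

  cases : Σ ℤ Cases
  cases with i ≟ j | i ≟ N | j ≟ N
  ... | yes i≡j | _ | _ = cases-diagonal i≡j
  ... | no i≢j | yes i≡N | _ = cases-top-i i≢j i≡N
  ... | no i≢j | no i≢N | yes j≡N = cases-top-j i≢j j≡N
  ... | no i≢j | no i≢N | no j≢N = cases-distinct (i≢j , i≢N , j≢N)

proposition4p2 : (m : ℕ) (σ τ : Permutation′ (suc m)) →
  let N = top m
      i = σ ⟨$⟩ˡ N
      j = τ ⟨$⟩ˡ N
      a = τ ⟨$⟩ʳ i
      b = σ ⟨$⟩ʳ j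
      c = σ ⟨$⟩ʳ N
      d = τ ⟨$⟩ʳ N
      ijN-distinct = (i ≢ j) × (i ≢ N) × (j ≢ N)
  in ((Δhd σ τ ≡ + 0) ⇔
        ((ijN-distinct × a ≢ b × c ≡ d)
       ⊎ (ijN-distinct × a ≡ b × c ≡ d)
       ⊎ (i ≡ j × i ≢ N × a ≡ N × b ≡ N × c ≢ d)
       ⊎ (i ≡ j × i ≢ N × a ≡ N × b ≡ N × c ≡ d)
       ⊎ (i ≡ N × j ≡ N × a ≡ N × b ≡ N × c ≡ N × d ≡ N)))
   × ((Δhd σ τ ≡ + 1) ⇔
        ((ijN-distinct × a ≢ b × a ≢ c × a ≢ d × b ≢ c × b ≢ d × c ≢ d)
       ⊎ (ijN-distinct × a ≡ b × c ≢ d)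
       ⊎ (i ≡ N × N ≢ j × a ≡ d × c ≡ N × a ≢ b × b ≢ c × a ≢ c)
       ⊎ (j ≡ N × N ≢ i × b ≡ c × d ≡ N × a ≢ b × b ≢ d × a ≢ d)))
   × ((Δhd σ τ ≡ + 2) ⇔
        ((ijN-distinct × a ≡ c × b ≢ d)
       ⊎ (ijN-distinct × a ≢ c × b ≡ d)
       ⊎ (i ≡ N × N ≢ j × a ≡ b × b ≡ d × d ≢ c × c ≡ N)
       ⊎ (j ≡ N × N ≢ i × a ≡ b × b ≡ c × c ≢ d × d ≡ N)))
   × ((Δhd σ τ ≡ + 3) ⇔
        (ijN-distinct × a ≡ c × b ≡ d))
proposition4p2 m σ τ = characterise (+ 0) , characterise (+ 1) , characterise (+ 2) , characterise (+ 3)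
  where
  open Configuration σ τ
  characterise : ∀ k → (Δhd σ τ ≡ k) ⇔ Cases k
  characterise = cases⇒≡⇔ Cases Δhd-cases cases
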